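{- The game values of partisan chocolate game positions are numbers.
   Context: Partisan chocolate game: a component is a rectangular chocolate bar of square cells; the bottom-left cell is poisoned (black), the others are colored blue and red in checkerboard fashion with the cells orthogonally adjacent to the poisoned one blue. Left may cut along a vertical line if the top square of the column immediately to the right of that line is blue, or along a horizontal line if the rightmost square of the row just above that line is blue; Right may make the same moves when the corresponding square is red. After a cut, the player eats the portion not containing the poisoned square. Normal play (the player who cannot move loses). Numbers are game values in the sense of combinatorial game theory (here dyadic rationals). -}

module Defs where

open import Data.Nat using (ℕ; zero; suc; _+_; _∸_; _%_; _≡ᵇ_)
open import Data.Bool using (Bool; true; false; if_then_else_)
open import Data.List using (List; []; _∷_; [_]; _++_; map; concatMap; upTo)
open import Data.List.Membership.Propositional using (_∈_)
open import Data.Product using (_×_)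
open import Data.Unit using (⊤)
open import Relation.Nullary using (¬_)

data Game : Set where
  ⟨_∣_⟩ : List Game → List Game → Game

mutual
  _≤_ : Game → Game → Set
  ⟨ GL ∣ GR ⟩ ≤ ⟨ HL ∣ HR ⟩ = NoLeftAbove GL ⟨ HL ∣ HR ⟩ × NoRightBelow HR ⟨ GL ∣ GR ⟩

  NoLeftAbove : List Game → Game → Set
  NoLeftAbove []       H = ⊤
  NoLeftAbove (g ∷ gs) H = ¬ (H ≤ g) × NoLeftAbove gs H

  NoRightBelow : List Game → Game → Set
  NoRightBelow []       G = ⊤
  NoRightBelow (h ∷ hs) G = ¬ (h ≤ G) × NoRightBelow hs G

infix 4 _≤_

_≈_ : Game → Game → Set
G ≈ H = G ≤ H × H ≤ G

infix 4 _≈_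

mutual
  IsNumber : Game → Set
  IsNumber ⟨ GL ∣ GR ⟩ =
    AllNumbers GL × AllNumbers GR × (∀ {l r} → l ∈ GL → r ∈ GR → ¬ (r ≤ l))

  AllNumbers : List Game → Set
  AllNumbers []       = ⊤
  AllNumbers (g ∷ gs) = IsNumber g × AllNumbers gs

ValueIsNumber : Game → Set
ValueIsNumber G = Data.Product.∃ λ x → IsNumber x × G ≈ x

-- Cell (i , j): column i (from the left, starting at 0), row j (from the
-- bottom, starting at 0).  Cell (0,0) is poisoned; the others are coloured
-- in checkerboard fashion with (1,0) and (0,1) blue, i.e. blue iff i + j odd.

data Colour : Set where
  poison blue red : Colour

parityColour : ℕ → Colour
parityColour n = if n % 2 ≡ᵇ 1 then blue else red

colour : ℕ → ℕ → Colour
colour zero    zero    = poison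
colour zero    (suc j) = parityColour (suc j)
colour (suc i) j       = parityColour (suc i + j)

isColour : Colour → Colour → Bool
isColour poison poison = true
isColour blue   blue   = true
isColour red    red    = true
isColour _      _      = false

cutPositions : ℕ → List ℕ
cutPositions n = map suc (upTo (n ∸ 1))

-- Options of the bar of width w and height h for the player whose colour
-- is c, computed with a fuel parameter (each cut decreases w + h).
--   * vertical cut between columns k-1 and k (1 ≤ k ≤ w-1): allowed if the
--     top square (k , h-1) of column k has colour c; leaves the w'=k × h bar.
--   * horizontal cut between rows k-1 and k (1 ≤ k ≤ h-1): allowed if the
--     rightmost square (w-1 , k) of row k has colour c; leaves the w × k bar.
mutual
  chocF : ℕ → ℕ → ℕ → Game
  chocF zero     w h = ⟨ [] ∣ [] ⟩
  chocF (suc f) w h = ⟨ opts f blue w h ∣ opts f red w h ⟩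

  opts : ℕ → Colour → ℕ → ℕ → List Game
  opts f c w h =
    concatMap (λ k → if isColour c (colour k (h ∸ 1)) then [ chocF f k h ] else [])
              (cutPositions w)
    ++
    concatMap (λ k → if isColour c (colour (w ∸ 1) k) then [ chocF f w k ] else [])
              (cutPositions h)

-- The chocolate bar with w columns and h rows (w , h ≥ 1).  Fuel w + h
-- suffices since every move decreases w + h by at least one.
choc : ℕ → ℕ → Game
choc w h = chocF (w + h) w h

module Submission where

-- Give the bar with w + 1 columns and h + 1 rows the key (parity of w + h, ⌊w/2⌋ + ⌊h/2⌋).
-- A Left move always leads to a bar with w + h even, a Right move to one with w + h odd.
-- Order the keys so that even keys increase with the index, odd keys decrease with it, and
-- every even key lies below every odd one.  By simultaneous induction, two bars compare as
-- games exactly as their keys do: the Left options of a bar have smaller keys and its Right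
-- options larger ones, and whenever two keys are strictly ordered, removing one or two lines
-- from one of the bars produces an option witnessing the strict inequality of the games.
-- In particular no Left option of a bar is ≥ one of its Right options, so every bar is
-- itself a number.

open import Defs
open import Data.Nat
  using (ℕ; zero; suc; _+_; _≥_; _<_; ⌊_/2⌋; parity; _≤?_; s≤s)
  renaming (_≤_ to _≤ℕ_)
open import Data.Nat.Properties
  using (≤-refl; ≤-pred; <-≤-trans; ≤-<-trans; n<1+n; m<n⇒m<1+n; +-suc; +-comm;
         +-monoˡ-<; +-monoʳ-<; +-monoˡ-≤; +-monoʳ-≤; n≤1+n; ≰⇒>; m≤n⇒m<n∨m≡n; ⌊n/2⌋-mono)
open import Data.Parity.Base using (Parity; 0ℙ; 1ℙ; _⁻¹)
import Data.Parity.Base as ℙ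
open import Data.Parity.Properties using (suc-homo-⁻¹; +-homo-+; p≢p⁻¹; +-cancelʳ-≡; +-cancelˡ-≡)
open import Data.Bool using (Bool; true; if_then_else_)
open import Data.List using (List; []; _∷_; [_]; _++_; concat; concatMap; upTo)
open import Data.List.Properties using (map-cong-local)
open import Data.List.Relation.Unary.All using (tabulate)
open import Data.List.Relation.Unary.Any using (here; there)
open import Data.List.Membership.Propositional using (_∈_; find; lose)
open import Data.List.Membership.Propositional.Properties
  using (∈-++⁻; ∈-++⁺ˡ; ∈-++⁺ʳ; ∈-concatMap⁺; ∈-concatMap⁻; ∈-map⁺; ∈-map⁻; ∈-upTo⁺; ∈-upTo⁻)
open import Data.Product using (_×_; _,_; proj₁; proj₂; ∃-syntax)
open import Data.Sum using (_⊎_; inj₁; inj₂)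
open import Data.Unit using (⊤; tt)
open import Data.Empty using (⊥; ⊥-elim)
open import Relation.Nullary using (¬_; yes; no)
open import Function using (_∘_)
open import Relation.Binary.PropositionalEquality using (_≡_; refl; sym; trans; cong; cong₂; subst)

-- A parity doubles as a player: 0ℙ is Left (blue), 1ℙ is Right (red).
options : Parity → Game → List Game
options 0ℙ ⟨ L ∣ R ⟩ = L
options 1ℙ ⟨ L ∣ R ⟩ = R

noLeftAbove⁺ : ∀ {H} gs → (∀ {g} → g ∈ gs → ¬ H ≤ g) → NoLeftAbove gs H
noLeftAbove⁺ []       _  = tt
noLeftAbove⁺ (g ∷ gs) ¬≤ = ¬≤ (here refl) , noLeftAbove⁺ gs (¬≤ ∘ there)

noLeftAbove⁻ : ∀ {H g} gs → NoLeftAbove gs H → g ∈ gs → ¬ H ≤ g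
noLeftAbove⁻ (_ ∷ gs) (¬≤ , _)    (here refl) = ¬≤
noLeftAbove⁻ (_ ∷ gs) (_  , rest) (there g∈)  = noLeftAbove⁻ gs rest g∈

noRightBelow⁺ : ∀ {G} hs → (∀ {h} → h ∈ hs → ¬ h ≤ G) → NoRightBelow hs G
noRightBelow⁺ []       _  = tt
noRightBelow⁺ (h ∷ hs) ¬≤ = ¬≤ (here refl) , noRightBelow⁺ hs (¬≤ ∘ there)

noRightBelow⁻ : ∀ {G h} hs → NoRightBelow hs G → h ∈ hs → ¬ h ≤ G
noRightBelow⁻ (_ ∷ hs) (¬≤ , _)    (here refl) = ¬≤
noRightBelow⁻ (_ ∷ hs) (_  , rest) (there h∈)  = noRightBelow⁻ hs rest h∈

≤-intro : ∀ {G H} →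
          (∀ {g} → g ∈ options 0ℙ G → ¬ H ≤ g) →
          (∀ {h} → h ∈ options 1ℙ H → ¬ h ≤ G) →
          G ≤ H
≤-intro {⟨ GL ∣ _ ⟩} {⟨ _ ∣ HR ⟩} left right = noLeftAbove⁺ GL left , noRightBelow⁺ HR right

≤⇒¬≤leftOption : ∀ {G H g} → G ≤ H → g ∈ options 0ℙ G → ¬ H ≤ g
≤⇒¬≤leftOption {⟨ GL ∣ _ ⟩} {⟨ _ ∣ _ ⟩} (left , _) = noLeftAbove⁻ GL left

≤⇒¬rightOption≤ : ∀ {G H h} → G ≤ H → h ∈ options 1ℙ H → ¬ h ≤ G
≤⇒¬rightOption≤ {⟨ _ ∣ _ ⟩} {⟨ _ ∣ HR ⟩} (_ , right) = noRightBelow⁻ HR right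

allNumbers⁺ : ∀ gs → (∀ {g} → g ∈ gs → IsNumber g) → AllNumbers gs
allNumbers⁺ []       _   = tt
allNumbers⁺ (g ∷ gs) num = num (here refl) , allNumbers⁺ gs (num ∘ there)

isNumber⁺ : ∀ {G} →
            (∀ s {g} → g ∈ options s G → IsNumber g) →
            (∀ {l r} → l ∈ options 0ℙ G → r ∈ options 1ℙ G → ¬ r ≤ l) →
            IsNumber G
isNumber⁺ {⟨ GL ∣ GR ⟩} num separated = allNumbers⁺ GL (num 0ℙ) , allNumbers⁺ GR (num 1ℙ) , separated

select : (ℕ → Bool) → (ℕ → Game) → ℕ → List Game
select keep G n = concatMap (λ k → if keep k then [ G k ] else []) (cutPositions n)

∈-select⁻ : ∀ keep G n {g} → g ∈ select keep G (suc n) →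
            ∃[ a ] a < n × keep (suc a) ≡ true × g ≡ G (suc a)
∈-select⁻ keep G n g∈
  with find (∈-concatMap⁻ (λ k → if keep k then [ G k ] else []) {xs = cutPositions (suc n)} g∈)
... | k , k∈ , g∈k with ∈-map⁻ suc {xs = upTo n} k∈
... | a , a∈ , refl with keep (suc a) in kept | g∈k
... | true | here refl = a , ∈-upTo⁻ a∈ , kept , refl

∈-select⁺ : ∀ keep G n {a} → a < n → keep (suc a) ≡ true → G (suc a) ∈ select keep G (suc n)
∈-select⁺ keep G n {a} a<n kept =
  ∈-concatMap⁺ (λ k → if keep k then [ G k ] else [])
    (lose (∈-map⁺ suc (∈-upTo⁺ a<n))
          (subst (λ b → G (suc a) ∈ (if b then [ G (suc a) ] else [])) (sym kept) (here refl)))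

∈-cutPositions⁻ : ∀ {n k} → k ∈ cutPositions n → k < n
∈-cutPositions⁻ {suc n} k∈ with ∈-map⁻ suc k∈
... | j , j∈ , refl = s≤s (∈-upTo⁻ j∈)

select-cong : ∀ keep {G G′} n → (∀ {k} → k < n → G k ≡ G′ k) → select keep G n ≡ select keep G′ n
select-cong keep n G≡G′ = cong concat (map-cong-local (tabulate λ {k} k∈ →
  cong (λ g → if keep k then [ g ] else []) (G≡G′ (∈-cutPositions⁻ k∈))))

chocF-empty : ∀ f → chocF f 0 0 ≡ ⟨ [] ∣ [] ⟩
chocF-empty zero    = refl
chocF-empty (suc f) = refl

mutual
  chocF-fuel : ∀ {f f′} w h → w + h ≤ℕ f → w + h ≤ℕ f′ → chocF f w h ≡ chocF f′ w h
  chocF-fuel {zero}  {f′}     zero    zero    _ _ = sym (chocF-empty f′)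
  chocF-fuel {zero}           (suc w) h       () _
  chocF-fuel {zero}           zero    (suc h) () _
  chocF-fuel {suc f} {zero}   zero    zero    _ _ = chocF-empty (suc f)
  chocF-fuel {suc f} {zero}   (suc w) h       _ ()
  chocF-fuel {suc f} {zero}   zero    (suc h) _ ()
  chocF-fuel {suc f} {suc f′} w       h       ≤f ≤f′ =
    cong₂ ⟨_∣_⟩ (opts-fuel blue w h ≤f ≤f′) (opts-fuel red w h ≤f ≤f′)

  opts-fuel : ∀ {f f′} c w h → w + h ≤ℕ suc f → w + h ≤ℕ suc f′ →
              opts f c w h ≡ opts f′ c w h
  opts-fuel c w h ≤f ≤f′ = cong₂ _++_
    (select-cong _ w λ k<w → let k+h< = +-monoˡ-< h k<w in
      chocF-fuel _ h (≤-pred (<-≤-trans k+h< ≤f)) (≤-pred (<-≤-trans k+h< ≤f′)))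
    (select-cong _ h λ k<h → let w+k< = +-monoʳ-< w k<h in
      chocF-fuel w _ (≤-pred (<-≤-trans w+k< ≤f)) (≤-pred (<-≤-trans w+k< ≤f′)))

sideColour : Parity → Colour
sideColour 0ℙ = blue
sideColour 1ℙ = red

parityColour-suc : ∀ n → parityColour (suc n) ≡ sideColour (parity n)
parityColour-suc zero          = refl
parityColour-suc (suc zero)    = refl
parityColour-suc (suc (suc n)) = parityColour-suc n

colour-column : ∀ a h → colour (suc a) h ≡ sideColour (parity (a + h))
colour-column a h = parityColour-suc (a + h)

colour-row : ∀ w b → colour w (suc b) ≡ sideColour (parity (w + b))
colour-row zero    b = parityColour-suc b
colour-row (suc w) b =
  trans (cong (parityColour ∘ suc) (+-suc w b)) (parityColour-suc (suc w + b))

sideColour-isColour⁻ : ∀ {s c t} → c ≡ sideColour t → isColour (sideColour s) c ≡ true → s ≡ t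
sideColour-isColour⁻ {0ℙ} {t = 0ℙ} refl _ = refl
sideColour-isColour⁻ {1ℙ} {t = 1ℙ} refl _ = refl

sideColour-isColour⁺ : ∀ {s c} → c ≡ sideColour s → isColour (sideColour s) c ≡ true
sideColour-isColour⁺ {0ℙ} refl = refl
sideColour-isColour⁺ {1ℙ} refl = refl

-- (w , h) stands for the bar with w + 1 columns and h + 1 rows.
Bar : Set
Bar = ℕ × ℕ

bar : Bar → Game
bar (w , h) = choc (suc w) (suc h)

size : Bar → ℕ
size (w , h) = w + h

side : Bar → Parity
side (w , h) = parity (w + h)

data Cut : Bar → Bar → Set where
  column : ∀ {a w h} → a < w → Cut (a , h) (w , h)
  row    : ∀ {b w h} → b < h → Cut (w , b) (w , h)

Cut⇒size< : ∀ {q p} → Cut q p → size q < size p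
Cut⇒size< {_ , h} (column a<w) = +-monoˡ-< h a<w
Cut⇒size< {w , _} (row b<h)    = +-monoʳ-< w b<h

keepColumn keepRow : Parity → ℕ → ℕ → Bool
keepColumn s h k = isColour (sideColour s) (colour k h)
keepRow    s w k = isColour (sideColour s) (colour w k)

columnBar rowBar : ℕ → ℕ → ℕ → Game
columnBar w h k = chocF (w + suc h) k (suc h)
rowBar    w h k = chocF (w + suc h) (suc w) k

columnOptions rowOptions : Parity → ℕ → ℕ → List Game
columnOptions s w h = select (keepColumn s h) (columnBar w h) (suc w)
rowOptions    s w h = select (keepRow s w) (rowBar w h) (suc h)

options-bar : ∀ s w h → options s (bar (w , h)) ≡ columnOptions s w h ++ rowOptions s w h
options-bar 0ℙ w h = refl
options-bar 1ℙ w h = refl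

columnBar≡bar : ∀ {a w h} → a < w → columnBar w h (suc a) ≡ bar (a , h)
columnBar≡bar {a} {h = h} a<w = chocF-fuel (suc a) (suc h) (+-monoˡ-≤ (suc h) a<w) ≤-refl

rowBar≡bar : ∀ {b w h} → b < h → rowBar w h (suc b) ≡ bar (w , b)
rowBar≡bar {b} {w} {h} b<h =
  chocF-fuel (suc w) (suc b) (subst (_≤ℕ w + suc h) (+-suc w (suc b)) (+-monoʳ-≤ w (s≤s b<h)))
             ≤-refl

∈-options⁻ : ∀ s p {g} → g ∈ options s (bar p) → ∃[ q ] Cut q p × side q ≡ s × g ≡ bar q
∈-options⁻ s (w , h) {g} g∈ with ∈-++⁻ (columnOptions s w h) (subst (g ∈_) (options-bar s w h) g∈)
... | inj₁ g∈col
  with a , a<w , kept , refl ← ∈-select⁻ (keepColumn s h) (columnBar w h) w g∈col =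
  (a , h) , column a<w , sym (sideColour-isColour⁻ (colour-column a h) kept) , columnBar≡bar a<w
... | inj₂ g∈row
  with b , b<h , kept , refl ← ∈-select⁻ (keepRow s w) (rowBar w h) h g∈row =
  (w , b) , row b<h , sym (sideColour-isColour⁻ (colour-row w b) kept) , rowBar≡bar b<h

∈-options⁺ : ∀ {s q p} → Cut q p → side q ≡ s → bar q ∈ options s (bar p)
∈-options⁺ {s} {a , h} {w , _} (column a<w) refl =
  subst (bar (a , h) ∈_) (sym (options-bar s w h)) (∈-++⁺ˡ ∈columns)
  where
  ∈columns : bar (a , h) ∈ columnOptions s w h
  ∈columns = subst (_∈ columnOptions s w h) (columnBar≡bar a<w)
    (∈-select⁺ (keepColumn s h) (columnBar w h) w a<w (sideColour-isColour⁺ (colour-column a h)))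
∈-options⁺ {s} {w , b} {_ , h} (row b<h) refl =
  subst (bar (w , b) ∈_) (sym (options-bar s w h)) (∈-++⁺ʳ _ ∈rows)
  where
  ∈rows : bar (w , b) ∈ rowOptions s w h
  ∈rows = subst (_∈ rowOptions s w h) (rowBar≡bar b<h)
    (∈-select⁺ (keepRow s w) (rowBar w h) h b<h (sideColour-isColour⁺ (colour-row w b)))

parity-+-cancelʳ : ∀ a w h → parity (a + h) ≡ parity (w + h) → parity a ≡ parity w
parity-+-cancelʳ a w h eq =
  +-cancelʳ-≡ (parity h) (parity a) (parity w) (trans (sym (+-homo-+ a h)) (trans eq (+-homo-+ w h)))

parity-+-cancelˡ : ∀ w b h → parity (w + b) ≡ parity (w + h) → parity b ≡ parity h
parity-+-cancelˡ w b h eq =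
  +-cancelˡ-≡ (parity w) (parity b) (parity h) (trans (sym (+-homo-+ w b)) (trans eq (+-homo-+ w h)))

<∧parity≡⇒1+< : ∀ {m n} → m < n → parity m ≡ parity n → suc m < n
<∧parity≡⇒1+< {m} m<n eq with m≤n⇒m<n∨m≡n m<n
... | inj₁ 1+m<n = 1+m<n
... | inj₂ refl  = ⊥-elim (p≢p⁻¹ (parity (suc m)) (trans (sym eq) (sym (suc-homo-⁻¹ m))))

⌊/2⌋-<-parity≡ : ∀ {m n} → m < n → parity m ≡ parity n → ⌊ m /2⌋ < ⌊ n /2⌋
⌊/2⌋-<-parity≡ m<n eq = ⌊n/2⌋-mono (<∧parity≡⇒1+< m<n eq)

⌊1+n/2⌋≤1+⌊n/2⌋ : ∀ n → ⌊ suc n /2⌋ ≤ℕ suc ⌊ n /2⌋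
⌊1+n/2⌋≤1+⌊n/2⌋ n = ⌊n/2⌋-mono (n≤1+n (suc n))

odd⇒pred-even : ∀ n → parity n ≡ 1ℙ → ∃[ m ] n ≡ suc m × parity m ≡ 0ℙ × ⌊ m /2⌋ ≡ ⌊ n /2⌋
odd⇒pred-even (suc zero)    _   = 0 , refl , refl , refl
odd⇒pred-even (suc (suc n)) odd with m , refl , even , half ← odd⇒pred-even n odd =
  suc (suc m) , refl , even , cong suc half

index : Bar → ℕ
index (w , h) = ⌊ w /2⌋ + ⌊ h /2⌋

Key : Set
Key = Parity × ℕ

key : Bar → Key
key p = side p , index p

_≼_ _≺_ : Key → Key → Set
(0ℙ , i) ≼ (0ℙ , j) = i ≤ℕ j
(0ℙ , _) ≼ (1ℙ , _) = ⊤
(1ℙ , _) ≼ (0ℙ , _) = ⊥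
(1ℙ , i) ≼ (1ℙ , j) = j ≤ℕ i
(0ℙ , i) ≺ (0ℙ , j) = i < j
(0ℙ , _) ≺ (1ℙ , _) = ⊤
(1ℙ , _) ≺ (0ℙ , _) = ⊥
(1ℙ , i) ≺ (1ℙ , j) = j < i

≼-refl : ∀ x → x ≼ x
≼-refl (0ℙ , _) = ≤-refl
≼-refl (1ℙ , _) = ≤-refl

≺-≼-trans : ∀ x y z → x ≺ y → y ≼ z → x ≺ z
≺-≼-trans (0ℙ , _) (0ℙ , _) (0ℙ , _) x≺y y≼z = <-≤-trans x≺y y≼z
≺-≼-trans (0ℙ , _) (0ℙ , _) (1ℙ , _) _   _   = tt
≺-≼-trans (0ℙ , _) (1ℙ , _) (1ℙ , _) _   _   = tt
≺-≼-trans (1ℙ , _) (1ℙ , _) (1ℙ , _) x≺y y≼z = ≤-<-trans y≼z x≺y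

≼-≺-trans : ∀ x y z → x ≼ y → y ≺ z → x ≺ z
≼-≺-trans (0ℙ , _) (0ℙ , _) (0ℙ , _) x≼y y≺z = ≤-<-trans x≼y y≺z
≼-≺-trans (0ℙ , _) (0ℙ , _) (1ℙ , _) _   _   = tt
≼-≺-trans (0ℙ , _) (1ℙ , _) (1ℙ , _) _   _   = tt
≼-≺-trans (1ℙ , _) (1ℙ , _) (1ℙ , _) x≼y y≺z = <-≤-trans y≺z x≼y

Cut⇒index< : ∀ {q p} → Cut q p → side q ≡ side p → index q < index p
Cut⇒index< {a , h} {w , _} (column a<w) eq =
  +-monoˡ-< ⌊ h /2⌋ (⌊/2⌋-<-parity≡ a<w (parity-+-cancelʳ a w h eq))
Cut⇒index< {w , b} {_ , h} (row b<h)    eq =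
  +-monoʳ-< ⌊ w /2⌋ (⌊/2⌋-<-parity≡ b<h (parity-+-cancelˡ w b h eq))

leftCut⇒≺ : ∀ {q p} → Cut q p → side q ≡ 0ℙ → key q ≺ key p
leftCut⇒≺ {q} {p} cut sq with side p in sp
... | 0ℙ rewrite sq = Cut⇒index< cut (trans sq (sym sp))
... | 1ℙ rewrite sq = tt

rightCut⇒≻ : ∀ {q p} → Cut q p → side q ≡ 1ℙ → key p ≺ key q
rightCut⇒≻ {q} {p} cut sq with side p in sp
... | 0ℙ rewrite sq = tt
... | 1ℙ rewrite sq = Cut⇒index< cut (trans sq (sym sp))

even≺odd : ∀ {p q} → side p ≡ 0ℙ → side q ≡ 1ℙ → key p ≺ key q
even≺odd sp sq rewrite sp | sq = tt

cutLoweringIndex : ∀ p {s i} → key p ≡ (s , suc i) → ∃[ q ] Cut q p × key q ≡ (s , i)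
cutLoweringIndex (suc (suc a) , h)     refl = (a , h) , column (m<n⇒m<1+n (n<1+n a)) , refl
cutLoweringIndex (0 , suc (suc c))     refl = (0 , c) , row (m<n⇒m<1+n (n<1+n c)) , refl
cutLoweringIndex (1 , suc (suc c))     refl = (1 , c) , row (m<n⇒m<1+n (n<1+n c)) , refl
cutLoweringIndex (0 , 0) ()
cutLoweringIndex (0 , 1) ()
cutLoweringIndex (1 , 0) ()
cutLoweringIndex (1 , 1) ()

cutOddToEven : ∀ p {i} → key p ≡ (1ℙ , i) → ∃[ q ] Cut q p × key q ≡ (0ℙ , i)
cutOddToEven (w , h) kp
  with parity w in pw | parity h in ph | trans (sym (+-homo-+ w h)) (cong proj₁ kp)
... | 1ℙ | 0ℙ | _ with m , refl , pm , half ← odd⇒pred-even w pw =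
  (m , h) , column (n<1+n m) ,
  cong₂ _,_ (trans (+-homo-+ m h) (cong₂ ℙ._+_ pm ph))
            (trans (cong (_+ ⌊ h /2⌋) half) (cong proj₂ kp))
... | 0ℙ | 1ℙ | _ with m , refl , pm , half ← odd⇒pred-even h ph =
  (w , m) , row (n<1+n m) ,
  cong₂ _,_ (trans (+-homo-+ w m) (cong₂ ℙ._+_ pw pm))
            (trans (cong (⌊ w /2⌋ +_) half) (cong proj₂ kp))

cutEvenToOdd : ∀ p {i j} → key p ≡ (0ℙ , j) → i < j →
               ∃[ q ] Cut q p × side q ≡ 1ℙ × i ≤ℕ index q
cutEvenToOdd (suc a , h) kp i<j =
  (a , h) , column (n<1+n a) ,
  trans (sym (suc-homo-⁻¹ (a + h))) (cong (_⁻¹ ∘ proj₁) kp) ,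
  ≤-pred (<-≤-trans i<j (subst (_≤ℕ suc (index (a , h))) (cong proj₂ kp)
                                (+-monoˡ-≤ ⌊ h /2⌋ (⌊1+n/2⌋≤1+⌊n/2⌋ a))))
cutEvenToOdd (0 , suc c) kp i<j =
  (0 , c) , row (n<1+n c) ,
  trans (sym (suc-homo-⁻¹ c)) (cong (_⁻¹ ∘ proj₁) kp) ,
  ≤-pred (<-≤-trans i<j (subst (_≤ℕ suc (index (0 , c))) (cong proj₂ kp)
                                (⌊1+n/2⌋≤1+⌊n/2⌋ c)))
cutEvenToOdd (0 , 0) refl ()

≼-odd : ∀ {s i j} → s ≡ 1ℙ → j ≤ℕ i → (s , i) ≼ (1ℙ , j)
≼-odd refl j≤i = j≤i

≺⇒separatingCut : ∀ p q → key q ≺ key p →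
                    (∃[ p′ ] Cut p′ p × side p′ ≡ 0ℙ × key q ≼ key p′)
                  ⊎ (∃[ q′ ] Cut q′ q × side q′ ≡ 1ℙ × key q′ ≼ key p)
≺⇒separatingCut p q q≺p with key p in kp | key q in kq
... | 0ℙ , suc i | 0ℙ , j with p′ , cut , kp′ ← cutLoweringIndex p kp =
  inj₁ (p′ , cut , cong proj₁ kp′ , subst ((0ℙ , j) ≼_) (sym kp′) (≤-pred q≺p))
... | 1ℙ , i | 1ℙ , suc j with q′ , cut , kq′ ← cutLoweringIndex q kq =
  inj₂ (q′ , cut , cong proj₁ kq′ , subst (_≼ (1ℙ , i)) (sym kq′) (≤-pred q≺p))
... | 1ℙ , i | 0ℙ , j with j ≤? i
...   | yes j≤i with p′ , cut , kp′ ← cutOddToEven p kp =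
  inj₁ (p′ , cut , cong proj₁ kp′ , subst ((0ℙ , j) ≼_) (sym kp′) j≤i)
...   | no j≰i with q′ , cut , sq′ , i≤ ← cutEvenToOdd q kq (≰⇒> j≰i) =
  inj₂ (q′ , cut , sq′ , ≼-odd sq′ i≤)

shrinkˡ : ∀ {a′ a} b {n} → a′ < a → a + b < suc n → b + a′ < n
shrinkˡ {a′} {a} b {n} a′<a bound =
  <-≤-trans (+-monoʳ-< b a′<a) (subst (_≤ℕ n) (+-comm a b) (≤-pred bound))

shrinkʳ : ∀ a {b′ b n} → b′ < b → a + b < suc n → b′ + a < n
shrinkʳ a {b′} {b} {n} b′<b bound =
  <-≤-trans (+-monoˡ-< a b′<b) (subst (_≤ℕ n) (+-comm a b) (≤-pred bound))

mutual
  ≼⇒≤ : ∀ n p q → size p + size q < n → key p ≼ key q → bar p ≤ bar q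
  ≼⇒≤ (suc n) p q bound p≼q = ≤-intro leftOption rightOption
    where
    leftOption : ∀ {g} → g ∈ options 0ℙ (bar p) → ¬ bar q ≤ g
    leftOption g∈ with p′ , cut , sp′ , refl ← ∈-options⁻ 0ℙ p g∈ =
      ≺⇒≰ n q p′ (shrinkˡ (size q) (Cut⇒size< cut) bound)
            (≺-≼-trans (key p′) (key p) (key q) (leftCut⇒≺ cut sp′) p≼q)
    rightOption : ∀ {g} → g ∈ options 1ℙ (bar q) → ¬ g ≤ bar p
    rightOption g∈ with q′ , cut , sq′ , refl ← ∈-options⁻ 1ℙ q g∈ =
      ≺⇒≰ n q′ p (shrinkʳ (size p) (Cut⇒size< cut) bound)
            (≼-≺-trans (key p) (key q) (key q′) p≼q (rightCut⇒≻ cut sq′))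

  ≺⇒≰ : ∀ n p q → size p + size q < n → key q ≺ key p → ¬ bar p ≤ bar q
  ≺⇒≰ (suc n) p q bound q≺p p≤q with ≺⇒separatingCut p q q≺p
  ... | inj₁ (p′ , cut , sp′ , q≼p′) =
    ≤⇒¬≤leftOption p≤q (∈-options⁺ cut sp′)
      (≼⇒≤ n q p′ (shrinkˡ (size q) (Cut⇒size< cut) bound) q≼p′)
  ... | inj₂ (q′ , cut , sq′ , q′≼p) =
    ≤⇒¬rightOption≤ p≤q (∈-options⁺ cut sq′)
      (≼⇒≤ n q′ p (shrinkʳ (size p) (Cut⇒size< cut) bound) q′≼p)

bar-isNumber : ∀ n p → size p < n → IsNumber (bar p)
bar-isNumber (suc n) p bound = isNumber⁺ optionIsNumber leftNotAboveRight
  where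
  optionIsNumber : ∀ s {g} → g ∈ options s (bar p) → IsNumber g
  optionIsNumber s g∈ with q , cut , _ , refl ← ∈-options⁻ s p g∈ =
    bar-isNumber n q (<-≤-trans (Cut⇒size< cut) (≤-pred bound))
  leftNotAboveRight : ∀ {l r} → l ∈ options 0ℙ (bar p) → r ∈ options 1ℙ (bar p) → ¬ r ≤ l
  leftNotAboveRight l∈ r∈
    with l , _ , sl , refl ← ∈-options⁻ 0ℙ p l∈
       | r , _ , sr , refl ← ∈-options⁻ 1ℙ p r∈ =
    ≺⇒≰ _ r l (n<1+n _) (even≺odd {l} {r} sl sr)

theorem4 : (w h : ℕ) → w ≥ 1 → h ≥ 1 → ValueIsNumber (choc w h)
theorem4 (suc w) (suc h) _ _ = bar p , bar-isNumber _ p (n<1+n _) , bar-≤-refl , bar-≤-refl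
  where
  p : Bar
  p = w , h
  bar-≤-refl : bar p ≤ bar p
  bar-≤-refl = ≼⇒≤ _ p p (n<1+n _) (≼-refl (key p))
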